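{- Let $\underline R$ be any EEC computation type and let $(\cdot)^\bullet$, $(\cdot)^\circ$ be the generic linear-use CPS self-translation of EEC relative to $\underline R$. Then: (1) If $\Gamma,x{:}A\mid-\vdash t:B$ and $\Gamma\mid-\vdash u:A$, then $\Gamma^\bullet\mid-\vdash (t[u/x])^\bullet=t^\bullet[u^\bullet/x]:B^\bullet$. (2) If $\Gamma,x{:}A\mid z{:}\underline D\vdash t:\underline B$ and $\Gamma\mid-\vdash u:A$, then $\Gamma^\bullet\mid k_z{:}\underline B^\circ\vdash (t[u/x])^\circ=t^\circ[u^\bullet/x]:\underline D^\circ$. (3) If $\Gamma\mid x{:}\underline A\vdash t:\underline B$ and $\Gamma\mid-\vdash u:\underline A$, then $\Gamma^\bullet\mid-\vdash (t[u/x])^\bullet=\hat\lambda k{:}\underline B^\circ.\,u^\bullet\{t^\circ[k/k_x]\}:\underline B^\circ\multimap\underline R$. (4) If $\Gamma\mid x{:}\underline A\vdash t:\underline B$ and $\Gamma\mid z{:}\underline D\vdash u:\underline A$, then $\Gamma^\bullet\mid k_z{:}\underline B^\circ\vdash (t[u/x])^\circ=u^\circ[(t^\circ[k_z/k_x])/k_z]:\underline D^\circ$.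
   Context: **EEC (enriched effect calculus).** There are value-type constants $\alpha,\beta,\ldots$ and a disjoint set of computation-type constants $\underline{\alpha},\underline{\beta},\ldots$. Value types $A,B,C$ and computation types $\underline{A},\underline{B},\underline{C},\underline{D}$ are generated by $A::=\alpha\mid 1\mid A\times B\mid A\to B\mid \underline{A}\mid \underline{A}\multimap\underline{B}$ and $\underline{A}::=\underline{\alpha}\mid\underline{1}\mid\underline{A}\,\&\,\underline{B}\mid A\Rightarrow\underline{B}\mid\underline{I}\mid\ !A\mid\ !A\otimes\underline{B}\mid\underline{0}\mid\underline{A}\oplus\underline{B}$ (every computation type is also a value type; $!A\otimes\underline{B}$ is one primitive binary constructor). Judgements are $\Gamma\mid -\vdash t:A$ and $\Gamma\mid z{:}\underline{A}\vdash t:\underline{B}$, where $\Gamma$ lists distinct variables with value types and the "stoup" holds at most one variable, of computation type; with nonempty stoup the result type is a computation type. Below $\Delta$ is empty or $z{:}\underline{D}$. Typing rules: $\Gamma,x{:}A\mid-\vdash x:A$; $\Gamma\mid-\vdash *:1$; pairs $\langle t,u\rangle:A\times B$, projections $\pi_1t,\pi_2t$; $\lambda x{:}A.t:A\to B$ from $\Gamma,x{:}A\mid-\vdash t:B$; application $t\,u$ (all with empty stoup). $\Gamma\mid z{:}\underline A\vdash z:\underline A$; $\Gamma\mid\Delta\vdash\underline{*}:\underline 1$; from $\Gamma\mid\Delta\vdash t:\underline A$, $\Gamma\mid\Delta\vdash u:\underline B$ get $\Gamma\mid\Delta\vdash\langle t,u\rangle_c:\underline A\,\&\,\underline B$, and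 from $\Gamma\mid\Delta\vdash t:\underline A\,\&\,\underline B$ get $\underline\pi_1t:\underline A$, $\underline\pi_2t:\underline B$; from $\Gamma,x{:}A\mid\Delta\vdash t:\underline B$ get $\Gamma\mid\Delta\vdash\underline\lambda x{:}A.t:A\Rightarrow\underline B$; from $\Gamma\mid\Delta\vdash s:A\Rightarrow\underline B$, $\Gamma\mid-\vdash t:A$ get $\Gamma\mid\Delta\vdash s@t:\underline B$; $\Gamma\mid-\vdash\top:\underline I$; from $\Gamma\mid\Delta\vdash t:\underline I$, $\Gamma\mid-\vdash u:\underline A$ get $\Gamma\mid\Delta\vdash \mathrm{let}\ \top\ \mathrm{be}\ t\ \mathrm{in}\ u:\underline A$; from $\Gamma\mid-\vdash t:A$ get $\Gamma\mid-\vdash\,!t:\,!A$; from $\Gamma\mid\Delta\vdash t:\,!A$, $\Gamma,x{:}A\mid-\vdash u:\underline B$ get $\Gamma\mid\Delta\vdash\mathrm{let}\ !x\ \mathrm{be}\ t\ \mathrm{in}\ u:\underline B$; from $\Gamma\mid-\vdash t:A$, $\Gamma\mid\Delta\vdash u:\underline B$ get $\Gamma\mid\Delta\vdash\,!t\otimes u:\,!A\otimes\underline B$; from $\Gamma\mid\Delta\vdash s:\,!A\otimes\underline B$, $\Gamma,x{:}A\mid y{:}\underline B\vdash t:\underline C$ get $\Gamma\mid\Delta\vdash\mathrm{let}\ !x\otimes y\ \mathrm{be}\ s\ \mathrm{in}\ t:\underline C$; from $\Gamma\mid\Delta\vdash t:\underline 0$ get $\Gamma\mid\Delta\vdash\mathrm{abort}_{\underline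 A}(t):\underline A$; $\mathrm{inl}\,t:\underline A\oplus\underline B$ from $t:\underline A$ and $\mathrm{inr}\,t$ from $t:\underline B$ (same $\Gamma\mid\Delta$); from $\Gamma\mid\Delta\vdash s:\underline A\oplus\underline B$, $\Gamma\mid x{:}\underline A\vdash t:\underline C$, $\Gamma\mid y{:}\underline B\vdash u:\underline C$ get $\Gamma\mid\Delta\vdash\mathrm{case}\ s\ \mathrm{of}\ (\mathrm{inl}\,x\Rightarrow t\mid\mathrm{inr}\,y\Rightarrow u):\underline C$; from $\Gamma\mid z{:}\underline A\vdash t:\underline B$ get $\Gamma\mid-\vdash\hat\lambda z{:}\underline A.t:\underline A\multimap\underline B$; from $\Gamma\mid-\vdash s:\underline A\multimap\underline B$, $\Gamma\mid\Delta\vdash t:\underline A$ get $\Gamma\mid\Delta\vdash s\{t\}:\underline B$. Equality $\Gamma\mid\Delta\vdash t=u:A$ is the least typed congruence (equivalence, compatible with all term formers, containing $\alpha$-equivalence) containing all well-typed instances of: $t=*$ for $t:1$; $\pi_1\langle t,u\rangle=t$, $\pi_2\langle t,u\rangle=u$, $\langle\pi_1t,\pi_2t\rangle=t$; $(\lambda x.t)u=t[u/x]$, $\lambda x.(t\,x)=t$ ($x$ not free in $t$); $t=\underline*$ for $t:\underline1$; $\underline\pi_1\langle t,u\rangle_c=t$, $\underline\pi_2\langle t,u\rangle_c=u$, $\langle\underline\pi_1t,\underline\pi_2t\rangle_c=t$; $(\underline\lambda x.t)@u=t[u/x]$, $\underline\lambda x.(t@x)=t$ ($x$ not free); $\mathrm{let}\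 \top\ \mathrm{be}\ \top\ \mathrm{in}\ t=t$; $\mathrm{let}\ \top\ \mathrm{be}\ t\ \mathrm{in}\ u[\top/x]=u[t/x]$ for $\Gamma\mid x{:}\underline I\vdash u:\underline A$; $\mathrm{let}\ !x\ \mathrm{be}\ !t\ \mathrm{in}\ u=u[t/x]$; $\mathrm{let}\ !x\ \mathrm{be}\ t\ \mathrm{in}\ u[!x/y]=u[t/y]$ for $\Gamma\mid y{:}\,!A\vdash u:\underline B$; $\mathrm{let}\ !x\otimes y\ \mathrm{be}\ !t\otimes s\ \mathrm{in}\ u=u[t/x,s/y]$; $\mathrm{let}\ !x\otimes y\ \mathrm{be}\ t\ \mathrm{in}\ u[(!x\otimes y)/z]=u[t/z]$ for $\Gamma\mid z{:}\,!A\otimes\underline B\vdash u:\underline C$; $\mathrm{abort}_{\underline A}(t)=u[t/x]$ for $\Gamma\mid x{:}\underline 0\vdash u:\underline A$; $\mathrm{case}\ \mathrm{inl}\,t\ \mathrm{of}\ (\mathrm{inl}\,x\Rightarrow u\mid\mathrm{inr}\,y\Rightarrow u')=u[t/x]$ and symmetrically for $\mathrm{inr}$; $\mathrm{case}\ t\ \mathrm{of}\ (\mathrm{inl}\,x\Rightarrow u[\mathrm{inl}\,x/z]\mid\mathrm{inr}\,y\Rightarrow u[\mathrm{inr}\,y/z])=u[t/z]$ for $\Gamma\mid z{:}\underline A\oplus\underline B\vdash u:\underline C$; $(\hat\lambda x.t)\{u\}=t[u/x]$, $\hat\lambda x.(t\{x\})=t$ ($x$ not free). **Generic self-translation relative to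 a computation type $\underline R$.** Types: $\alpha^\bullet=\alpha$, $1^\bullet=1$, $(A\times B)^\bullet=A^\bullet\times B^\bullet$, $(A\to B)^\bullet=A^\bullet\to B^\bullet$, $\underline A^\bullet=\underline A^\circ\multimap\underline R$ (a computation type viewed as a value type), $(\underline A\multimap\underline B)^\bullet=\underline B^\circ\multimap\underline A^\circ$; $\underline\alpha^\circ=\underline\alpha$ if $\underline\alpha\neq\underline R$ and $\underline\alpha^\circ=\underline I$ if $\underline R$ is the constant $\underline\alpha$; $\underline1^\circ=\underline0$; $(\underline A\,\&\,\underline B)^\circ=\underline A^\circ\oplus\underline B^\circ$; $(A\Rightarrow\underline B)^\circ=\,!(A^\bullet)\otimes\underline B^\circ$; $\underline I^\circ=\underline R$; $(!A)^\circ=A^\bullet\Rightarrow\underline R$; $(!A\otimes\underline B)^\circ=A^\bullet\Rightarrow\underline B^\circ$; $\underline0^\circ=\underline1$; $(\underline A\oplus\underline B)^\circ=\underline A^\circ\,\&\,\underline B^\circ$. For $\Gamma=x_1{:}C_1,\ldots,x_n{:}C_n$, $\Gamma^\bullet=x_1{:}C_1^\bullet,\ldots,x_n{:}C_n^\bullet$. To each variable $z$ is associated a distinct fresh variable $k_z$ (so iterating gives $k_{k_z}$); $k,h,k_x,k_y$ below are fresh bound variables. Terms: a judgement $\Gamma\mid-\vdash t:A$ goes to $\Gamma^\bullet\mid-\vdash t^\bullet:A^\bullet$, and $\Gamma\mid z{:}\underline D\vdash t:\underline B$ goes to $\Gamma^\bullet\mid k_z{:}\underline B^\circ\vdash t^\circ:\underline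 D^\circ$ (contravariantly); type names below refer to the typing rules. Value clauses: $x^\bullet=x$; $*^\bullet=*$; $\langle t,u\rangle^\bullet=\langle t^\bullet,u^\bullet\rangle$; $(\pi_it)^\bullet=\pi_it^\bullet$; $(\lambda x{:}A.t)^\bullet=\lambda x{:}A^\bullet.t^\bullet$; $(t\,u)^\bullet=t^\bullet\,u^\bullet$; $\underline*^\bullet=\hat\lambda k{:}\underline0.\,\mathrm{abort}_{\underline R}(k)$; $\langle t,u\rangle_c^\bullet=\hat\lambda k{:}\underline A^\circ\oplus\underline B^\circ.\,\mathrm{case}\ k\ \mathrm{of}\ (\mathrm{inl}\,k_x\Rightarrow t^\bullet\{k_x\}\mid\mathrm{inr}\,k_y\Rightarrow u^\bullet\{k_y\})$; $(\underline\pi_1t)^\bullet=\hat\lambda k{:}\underline A^\circ.\,t^\bullet\{\mathrm{inl}\,k\}$; $(\underline\pi_2t)^\bullet=\hat\lambda k{:}\underline B^\circ.\,t^\bullet\{\mathrm{inr}\,k\}$; $(\underline\lambda x{:}A.t)^\bullet=\hat\lambda k{:}\,!A^\bullet\otimes\underline B^\circ.\,\mathrm{let}\ !x\otimes h\ \mathrm{be}\ k\ \mathrm{in}\ t^\bullet\{h\}$; $(s@t)^\bullet=\hat\lambda k{:}\underline B^\circ.\,s^\bullet\{!(t^\bullet)\otimes k\}$; $\top^\bullet=\hat\lambda k{:}\underline R.\,k$; $(\mathrm{let}\ \top\ \mathrm{be}\ t\ \mathrm{in}\ u)^\bullet=\hat\lambda k{:}\underline A^\circ.\,t^\bullet\{u^\bullet\{k\}\}$;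 $(!t)^\bullet=\hat\lambda k{:}A^\bullet\Rightarrow\underline R.\,k@t^\bullet$; $(\mathrm{let}\ !x\ \mathrm{be}\ t\ \mathrm{in}\ u)^\bullet=\hat\lambda k{:}\underline B^\circ.\,t^\bullet\{\underline\lambda x{:}A^\bullet.\,u^\bullet\{k\}\}$; $(!t\otimes u)^\bullet=\hat\lambda k{:}A^\bullet\Rightarrow\underline B^\circ.\,u^\bullet\{k@t^\bullet\}$; $(\mathrm{let}\ !x\otimes y\ \mathrm{be}\ s\ \mathrm{in}\ t)^\bullet=\hat\lambda k{:}\underline C^\circ.\,s^\bullet\{\underline\lambda x{:}A^\bullet.\,t^\circ[k/k_y]\}$; $(\mathrm{abort}_{\underline A}(t))^\bullet=\hat\lambda k{:}\underline A^\circ.\,t^\bullet\{\underline*\}$; $(\mathrm{inl}\,t)^\bullet=\hat\lambda k{:}\underline A^\circ\,\&\,\underline B^\circ.\,t^\bullet\{\underline\pi_1k\}$; $(\mathrm{inr}\,t)^\bullet=\hat\lambda k{:}\underline A^\circ\,\&\,\underline B^\circ.\,t^\bullet\{\underline\pi_2k\}$; $(\mathrm{case}\ s\ \mathrm{of}\ (\mathrm{inl}\,x\Rightarrow t\mid\mathrm{inr}\,y\Rightarrow u))^\bullet=\hat\lambda k{:}\underline C^\circ.\,s^\bullet\{\langle t^\circ[k/k_x],u^\circ[k/k_y]\rangle_c\}$; $(\hat\lambda z{:}\underline A.t)^\bullet=\hat\lambda k{:}\underline B^\circ.\,t^\circ[k/k_z]$; $(s\{t\})^\bullet=\hat\lambda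 k{:}\underline B^\circ.\,t^\bullet\{s^\bullet\{k\}\}$. Computation clauses (stoup $z{:}\underline D$): $z^\circ=k_z$; $\underline*^\circ=\mathrm{abort}_{\underline D^\circ}(k_z)$; $\langle t,u\rangle_c^\circ=\mathrm{case}\ k_z\ \mathrm{of}\ (\mathrm{inl}\,k_x\Rightarrow t^\circ[k_x/k_z]\mid\mathrm{inr}\,k_y\Rightarrow u^\circ[k_y/k_z])$; $(\underline\pi_1t)^\circ=t^\circ[\mathrm{inl}\,k_z/k_z]$; $(\underline\pi_2t)^\circ=t^\circ[\mathrm{inr}\,k_z/k_z]$; $(\underline\lambda x{:}A.t)^\circ=\mathrm{let}\ !x\otimes h\ \mathrm{be}\ k_z\ \mathrm{in}\ t^\circ[h/k_z]$; $(s@t)^\circ=s^\circ[(!(t^\bullet)\otimes k_z)/k_z]$; $(\mathrm{let}\ \top\ \mathrm{be}\ t\ \mathrm{in}\ u)^\circ=t^\circ[u^\bullet\{k_z\}/k_z]$; $(\mathrm{let}\ !x\ \mathrm{be}\ t\ \mathrm{in}\ u)^\circ=t^\circ[(\underline\lambda x{:}A^\bullet.\,u^\bullet\{k_z\})/k_z]$; $(!t\otimes u)^\circ=u^\circ[(k_z@t^\bullet)/k_z]$; $(\mathrm{let}\ !x\otimes y\ \mathrm{be}\ s\ \mathrm{in}\ t)^\circ=s^\circ[(\underline\lambda x{:}A^\bullet.\,t^\circ[k_z/k_y])/k_z]$; $(\mathrm{abort}(t))^\circ=t^\circ[\underline*/k_z]$; $(\mathrm{inl}\,t)^\circ=t^\circ[\underline\pi_1k_z/k_z]$;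 $(\mathrm{inr}\,t)^\circ=t^\circ[\underline\pi_2k_z/k_z]$; $(\mathrm{case}\ s\ \mathrm{of}\ (\mathrm{inl}\,x\Rightarrow t\mid\mathrm{inr}\,y\Rightarrow u))^\circ=s^\circ[\langle t^\circ[k_z/k_x],u^\circ[k_z/k_y]\rangle_c/k_z]$; $(s\{t\})^\circ=t^\circ[s^\bullet\{k_z\}/k_z]$. -}

module Defs where

open import Data.Nat using (ℕ; _≡ᵇ_)
open import Data.Bool using (Bool; true; false; if_then_else_)
open import Data.Maybe using (Maybe; just; nothing)

data VTy : Set
data CTy : Set

infixr 6 _⇒ᵥ_ _⊸_
infixr 7 _×ᵥ_

data VTy where
  base  : ℕ → VTy
  𝟙     : VTy
  _×ᵥ_  : VTy → VTy → VTy
  _⇒ᵥ_  : VTy → VTy → VTy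
  ⌈_⌉   : CTy → VTy               -- a computation type viewed as value type
  _⊸_   : CTy → CTy → VTy

infixr 6 _⇒_
infixr 7 _&_ _⊕_
infixr 8 !_⊗_

data CTy where
  cbase : ℕ → CTy
  𝟙c    : CTy
  _&_   : CTy → CTy → CTy
  _⇒_   : VTy → CTy → CTy
  I     : CTy
  !_    : VTy → CTy
  !_⊗_  : VTy → CTy → CTy         -- !A ⊗ B (one primitive constructor)
  𝟘     : CTy
  _⊕_   : CTy → CTy → CTy

infixl 5 _▸_

data Ctx : Set where
  ε   : Ctx
  _▸_ : Ctx → VTy → Ctx

Stoup : Set
Stoup = Maybe CTy

variable
  Γ Θ : Ctx
  Δ : Stoup
  A A' B C : VTy
  P Q S D : CTy

data Var : Ctx → VTy → Set where
  vz : Var (Γ ▸ A) A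
  vs : Var Γ A → Var (Γ ▸ B) A

-- Intrinsically typed EEC terms:  Tm Γ Δ A  is  Γ | Δ ⊢ t : A.
-- Value variables are de Bruijn indices; the stoup variable is 'sv'.
-- (A term with nonempty stoup and non-computation result type is
-- uninhabited, as no rule produces one.)

data Tm (Γ : Ctx) : Stoup → VTy → Set where
  var       : Var Γ A → Tm Γ nothing A
  unit      : Tm Γ nothing 𝟙
  pair      : Tm Γ nothing A → Tm Γ nothing B → Tm Γ nothing (A ×ᵥ B)
  fst       : Tm Γ nothing (A ×ᵥ B) → Tm Γ nothing A
  snd       : Tm Γ nothing (A ×ᵥ B) → Tm Γ nothing B
  lam       : Tm (Γ ▸ A) nothing B → Tm Γ nothing (A ⇒ᵥ B)
  app       : Tm Γ nothing (A ⇒ᵥ B) → Tm Γ nothing A → Tm Γ nothing B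
  sv        : Tm Γ (just P) ⌈ P ⌉
  unitc     : Tm Γ Δ ⌈ 𝟙c ⌉
  pairc     : Tm Γ Δ ⌈ P ⌉ → Tm Γ Δ ⌈ Q ⌉ → Tm Γ Δ ⌈ P & Q ⌉
  fstc      : Tm Γ Δ ⌈ P & Q ⌉ → Tm Γ Δ ⌈ P ⌉
  sndc      : Tm Γ Δ ⌈ P & Q ⌉ → Tm Γ Δ ⌈ Q ⌉
  clam      : Tm (Γ ▸ A) Δ ⌈ Q ⌉ → Tm Γ Δ ⌈ A ⇒ Q ⌉
  capp      : Tm Γ Δ ⌈ A ⇒ Q ⌉ → Tm Γ nothing A → Tm Γ Δ ⌈ Q ⌉
  top       : Tm Γ nothing ⌈ I ⌉
  letTop    : Tm Γ Δ ⌈ I ⌉ → Tm Γ nothing ⌈ P ⌉ → Tm Γ Δ ⌈ P ⌉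
  bang      : Tm Γ nothing A → Tm Γ nothing ⌈ ! A ⌉
  letBang   : Tm Γ Δ ⌈ ! A ⌉ → Tm (Γ ▸ A) nothing ⌈ Q ⌉ → Tm Γ Δ ⌈ Q ⌉
  tensor    : Tm Γ nothing A → Tm Γ Δ ⌈ Q ⌉ → Tm Γ Δ ⌈ ! A ⊗ Q ⌉
  letTensor : Tm Γ Δ ⌈ ! A ⊗ Q ⌉ → Tm (Γ ▸ A) (just Q) ⌈ S ⌉ → Tm Γ Δ ⌈ S ⌉
  abort     : Tm Γ Δ ⌈ 𝟘 ⌉ → Tm Γ Δ ⌈ P ⌉
  inl       : Tm Γ Δ ⌈ P ⌉ → Tm Γ Δ ⌈ P ⊕ Q ⌉
  inr       : Tm Γ Δ ⌈ Q ⌉ → Tm Γ Δ ⌈ P ⊕ Q ⌉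
  case      : Tm Γ Δ ⌈ P ⊕ Q ⌉ → Tm Γ (just P) ⌈ S ⌉ → Tm Γ (just Q) ⌈ S ⌉
            → Tm Γ Δ ⌈ S ⌉
  llam      : Tm Γ (just P) ⌈ Q ⌉ → Tm Γ nothing (P ⊸ Q)
  lapp      : Tm Γ nothing (P ⊸ Q) → Tm Γ Δ ⌈ P ⌉ → Tm Γ Δ ⌈ Q ⌉

Ren : Ctx → Ctx → Set
Ren Γ Θ = ∀ {A} → Var Γ A → Var Θ A

liftR : Ren Γ Θ → Ren (Γ ▸ B) (Θ ▸ B)
liftR ρ vz     = vz
liftR ρ (vs x) = vs (ρ x)

ren : Ren Γ Θ → Tm Γ Δ A → Tm Θ Δ A
ren ρ (var x)         = var (ρ x)
ren ρ unit            = unit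
ren ρ (pair t u)      = pair (ren ρ t) (ren ρ u)
ren ρ (fst t)         = fst (ren ρ t)
ren ρ (snd t)         = snd (ren ρ t)
ren ρ (lam t)         = lam (ren (liftR ρ) t)
ren ρ (app t u)       = app (ren ρ t) (ren ρ u)
ren ρ sv              = sv
ren ρ unitc           = unitc
ren ρ (pairc t u)     = pairc (ren ρ t) (ren ρ u)
ren ρ (fstc t)        = fstc (ren ρ t)
ren ρ (sndc t)        = sndc (ren ρ t)
ren ρ (clam t)        = clam (ren (liftR ρ) t)
ren ρ (capp t u)      = capp (ren ρ t) (ren ρ u)
ren ρ top             = top
ren ρ (letTop t u)    = letTop (ren ρ t) (ren ρ u)
ren ρ (bang t)        = bang (ren ρ t)
ren ρ (letBang t u)   = letBang (ren ρ t) (ren (liftR ρ) u)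
ren ρ (tensor t u)    = tensor (ren ρ t) (ren ρ u)
ren ρ (letTensor s t) = letTensor (ren ρ s) (ren (liftR ρ) t)
ren ρ (abort t)       = abort (ren ρ t)
ren ρ (inl t)         = inl (ren ρ t)
ren ρ (inr t)         = inr (ren ρ t)
ren ρ (case s t u)    = case (ren ρ s) (ren ρ t) (ren ρ u)
ren ρ (llam t)        = llam (ren ρ t)
ren ρ (lapp s t)      = lapp (ren ρ s) (ren ρ t)

wk : Tm Γ Δ A → Tm (Γ ▸ B) Δ A
wk = ren vs

Sub : Ctx → Ctx → Set
Sub Γ Θ = ∀ {A} → Var Γ A → Tm Θ nothing A

liftS : Sub Γ Θ → Sub (Γ ▸ B) (Θ ▸ B)
liftS σ vz     = var vz
liftS σ (vs x) = wk (σ x)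

sub : Sub Γ Θ → Tm Γ Δ A → Tm Θ Δ A
sub σ (var x)         = σ x
sub σ unit            = unit
sub σ (pair t u)      = pair (sub σ t) (sub σ u)
sub σ (fst t)         = fst (sub σ t)
sub σ (snd t)         = snd (sub σ t)
sub σ (lam t)         = lam (sub (liftS σ) t)
sub σ (app t u)       = app (sub σ t) (sub σ u)
sub σ sv              = sv
sub σ unitc           = unitc
sub σ (pairc t u)     = pairc (sub σ t) (sub σ u)
sub σ (fstc t)        = fstc (sub σ t)
sub σ (sndc t)        = sndc (sub σ t)
sub σ (clam t)        = clam (sub (liftS σ) t)
sub σ (capp t u)      = capp (sub σ t) (sub σ u)
sub σ top             = top
sub σ (letTop t u)    = letTop (sub σ t) (sub σ u)
sub σ (bang t)        = bang (sub σ t)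
sub σ (letBang t u)   = letBang (sub σ t) (sub (liftS σ) u)
sub σ (tensor t u)    = tensor (sub σ t) (sub σ u)
sub σ (letTensor s t) = letTensor (sub σ s) (sub (liftS σ) t)
sub σ (abort t)       = abort (sub σ t)
sub σ (inl t)         = inl (sub σ t)
sub σ (inr t)         = inr (sub σ t)
sub σ (case s t u)    = case (sub σ s) (sub σ t) (sub σ u)
sub σ (llam t)        = llam (sub σ t)
sub σ (lapp s t)      = lapp (sub σ s) (sub σ t)

sub₀ : Tm Γ nothing A → Sub (Γ ▸ A) Γ
sub₀ u vz     = u
sub₀ u (vs x) = var x

-- t [ u ]₀  is  t[u/x]  for x the last variable of the context.
infixl 9 _[_]₀
_[_]₀ : Tm (Γ ▸ A) Δ B → Tm Γ nothing A → Tm Γ Δ B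
t [ u ]₀ = sub (sub₀ u) t

-- Substitution for the stoup variable:  ssub t u  is  t[u/z]
-- where  Γ | z:P ⊢ t : B  and  Γ | Δ ⊢ u : P.
ssub : Tm Γ (just P) A → Tm Γ Δ ⌈ P ⌉ → Tm Γ Δ A
ssub sv              u = u
ssub unitc           u = unitc
ssub (pairc t t')    u = pairc (ssub t u) (ssub t' u)
ssub (fstc t)        u = fstc (ssub t u)
ssub (sndc t)        u = sndc (ssub t u)
ssub (clam t)        u = clam (ssub t (wk u))
ssub (capp t v)      u = capp (ssub t u) v
ssub (letTop t v)    u = letTop (ssub t u) v
ssub (letBang t v)   u = letBang (ssub t u) v
ssub (tensor v t)    u = tensor v (ssub t u)
ssub (letTensor s t) u = letTensor (ssub s u) t
ssub (abort t)       u = abort (ssub t u)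
ssub (inl t)         u = inl (ssub t u)
ssub (inr t)         u = inr (ssub t u)
ssub (case s t t')   u = case (ssub s u) t t'
ssub (lapp s t)      u = lapp s (ssub t u)

infix 4 _≈_
data _≈_ : Tm Γ Δ A → Tm Γ Δ A → Set where
  ≈-refl  : {t : Tm Γ Δ A} → t ≈ t
  ≈-sym   : {t u : Tm Γ Δ A} → t ≈ u → u ≈ t
  ≈-trans : {t u v : Tm Γ Δ A} → t ≈ u → u ≈ v → t ≈ v
  c-pair  : {t t' : Tm Γ nothing A} {u u' : Tm Γ nothing B} → t ≈ t' → u ≈ u' → pair t u ≈ pair t' u'
  c-fst   : {t t' : Tm Γ nothing (A ×ᵥ B)} → t ≈ t' → fst t ≈ fst t'
  c-snd   : {t t' : Tm Γ nothing (A ×ᵥ B)} → t ≈ t' → snd t ≈ snd t'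
  c-lam   : {t t' : Tm (Γ ▸ A) nothing B} → t ≈ t' → lam t ≈ lam t'
  c-app   : {t t' : Tm Γ nothing (A ⇒ᵥ B)} {u u' : Tm Γ nothing A} → t ≈ t' → u ≈ u' → app t u ≈ app t' u'
  c-pairc : {t t' : Tm Γ Δ ⌈ P ⌉} {u u' : Tm Γ Δ ⌈ Q ⌉} → t ≈ t' → u ≈ u' → pairc t u ≈ pairc t' u'
  c-fstc  : {t t' : Tm Γ Δ ⌈ P & Q ⌉} → t ≈ t' → fstc t ≈ fstc t'
  c-sndc  : {t t' : Tm Γ Δ ⌈ P & Q ⌉} → t ≈ t' → sndc t ≈ sndc t'
  c-clam  : {t t' : Tm (Γ ▸ A) Δ ⌈ Q ⌉} → t ≈ t' → clam t ≈ clam t'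
  c-capp  : {t t' : Tm Γ Δ ⌈ A ⇒ Q ⌉} {u u' : Tm Γ nothing A} → t ≈ t' → u ≈ u' → capp t u ≈ capp t' u'
  c-letTop : {t t' : Tm Γ Δ ⌈ I ⌉} {u u' : Tm Γ nothing ⌈ P ⌉} → t ≈ t' → u ≈ u' → letTop t u ≈ letTop t' u'
  c-bang  : {t t' : Tm Γ nothing A} → t ≈ t' → bang t ≈ bang t'
  c-letBang : {t t' : Tm Γ Δ ⌈ ! A ⌉} {u u' : Tm (Γ ▸ A) nothing ⌈ Q ⌉} → t ≈ t' → u ≈ u' → letBang t u ≈ letBang t' u'
  c-tensor : {t t' : Tm Γ nothing A} {u u' : Tm Γ Δ ⌈ Q ⌉} → t ≈ t' → u ≈ u' → tensor t u ≈ tensor t' u'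
  c-letTensor : {s s' : Tm Γ Δ ⌈ ! A ⊗ Q ⌉} {t t' : Tm (Γ ▸ A) (just Q) ⌈ S ⌉} → s ≈ s' → t ≈ t' → letTensor s t ≈ letTensor s' t'
  c-abort : {t t' : Tm Γ Δ ⌈ 𝟘 ⌉} → t ≈ t' → abort {P = P} t ≈ abort t'
  c-inl   : {t t' : Tm Γ Δ ⌈ P ⌉} → t ≈ t' → inl {Q = Q} t ≈ inl t'
  c-inr   : {t t' : Tm Γ Δ ⌈ Q ⌉} → t ≈ t' → inr {P = P} t ≈ inr t'
  c-case  : {s s' : Tm Γ Δ ⌈ P ⊕ Q ⌉} {t t' : Tm Γ (just P) ⌈ S ⌉} {u u' : Tm Γ (just Q) ⌈ S ⌉}
          → s ≈ s' → t ≈ t' → u ≈ u' → case s t u ≈ case s' t' u'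
  c-llam  : {t t' : Tm Γ (just P) ⌈ Q ⌉} → t ≈ t' → llam t ≈ llam t'
  c-lapp  : {s s' : Tm Γ nothing (P ⊸ Q)} {t t' : Tm Γ Δ ⌈ P ⌉} → s ≈ s' → t ≈ t' → lapp s t ≈ lapp s' t'
  η-𝟙    : (t : Tm Γ nothing 𝟙) → t ≈ unit
  β-fst  : (t : Tm Γ nothing A) (u : Tm Γ nothing B) → fst (pair t u) ≈ t
  β-snd  : (t : Tm Γ nothing A) (u : Tm Γ nothing B) → snd (pair t u) ≈ u
  η-×    : (t : Tm Γ nothing (A ×ᵥ B)) → pair (fst t) (snd t) ≈ t
  β-→    : (t : Tm (Γ ▸ A) nothing B) (u : Tm Γ nothing A) → app (lam t) u ≈ t [ u ]₀
  η-→    : (t : Tm Γ nothing (A ⇒ᵥ B)) → lam (app (wk t) (var vz)) ≈ t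
  η-𝟙c   : (t : Tm Γ Δ ⌈ 𝟙c ⌉) → t ≈ unitc
  β-fstc : (t : Tm Γ Δ ⌈ P ⌉) (u : Tm Γ Δ ⌈ Q ⌉) → fstc (pairc t u) ≈ t
  β-sndc : (t : Tm Γ Δ ⌈ P ⌉) (u : Tm Γ Δ ⌈ Q ⌉) → sndc (pairc t u) ≈ u
  η-&    : (t : Tm Γ Δ ⌈ P & Q ⌉) → pairc (fstc t) (sndc t) ≈ t
  β-⇒    : (t : Tm (Γ ▸ A) Δ ⌈ Q ⌉) (u : Tm Γ nothing A) → capp (clam t) u ≈ t [ u ]₀
  η-⇒    : (t : Tm Γ Δ ⌈ A ⇒ Q ⌉) → clam (capp (wk t) (var vz)) ≈ t
  β-I    : (t : Tm Γ nothing ⌈ P ⌉) → letTop top t ≈ t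
  η-I    : (u : Tm Γ (just I) ⌈ P ⌉) (t : Tm Γ Δ ⌈ I ⌉) → letTop t (ssub u top) ≈ ssub u t
  β-!    : (t : Tm Γ nothing A) (u : Tm (Γ ▸ A) nothing ⌈ Q ⌉) → letBang (bang t) u ≈ u [ t ]₀
  η-!    : (u : Tm Γ (just (! A)) ⌈ Q ⌉) (t : Tm Γ Δ ⌈ ! A ⌉)
         → letBang t (ssub (wk u) (bang (var vz))) ≈ ssub u t
  β-⊗    : (t : Tm Γ nothing A) (s : Tm Γ Δ ⌈ Q ⌉) (u : Tm (Γ ▸ A) (just Q) ⌈ S ⌉)
         → letTensor (tensor t s) u ≈ ssub (u [ t ]₀) s
  η-⊗    : (u : Tm Γ (just (! A ⊗ Q)) ⌈ S ⌉) (t : Tm Γ Δ ⌈ ! A ⊗ Q ⌉)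
         → letTensor t (ssub (wk u) (tensor (var vz) sv)) ≈ ssub u t
  η-𝟘    : (u : Tm Γ (just 𝟘) ⌈ P ⌉) (t : Tm Γ Δ ⌈ 𝟘 ⌉) → abort t ≈ ssub u t
  β-inl  : (t : Tm Γ Δ ⌈ P ⌉) (u : Tm Γ (just P) ⌈ S ⌉) (u' : Tm Γ (just Q) ⌈ S ⌉)
         → case (inl t) u u' ≈ ssub u t
  β-inr  : (t : Tm Γ Δ ⌈ Q ⌉) (u : Tm Γ (just P) ⌈ S ⌉) (u' : Tm Γ (just Q) ⌈ S ⌉)
         → case (inr t) u u' ≈ ssub u' t
  η-⊕    : (u : Tm Γ (just (P ⊕ Q)) ⌈ S ⌉) (t : Tm Γ Δ ⌈ P ⊕ Q ⌉)
         → case t (ssub u (inl sv)) (ssub u (inr sv)) ≈ ssub u t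
  β-⊸    : (t : Tm Γ (just P) ⌈ Q ⌉) (u : Tm Γ Δ ⌈ P ⌉) → lapp (llam t) u ≈ ssub t u
  η-⊸    : (t : Tm Γ nothing (P ⊸ Q)) → llam (lapp t sv) ≈ t

isBase : CTy → ℕ → Bool
isBase (cbase m) n = m ≡ᵇ n
isBase _         n = false

module Trans (R : CTy) where

  infix 20 _•ᵀ _°ᵀ _• _°

  _•ᵀ : VTy → VTy
  _°ᵀ : CTy → CTy

  base n •ᵀ   = base n
  𝟙 •ᵀ        = 𝟙
  (A ×ᵥ B) •ᵀ = (A •ᵀ) ×ᵥ (B •ᵀ)
  (A ⇒ᵥ B) •ᵀ = (A •ᵀ) ⇒ᵥ (B •ᵀ)
  ⌈ P ⌉ •ᵀ    = (P °ᵀ) ⊸ R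
  (P ⊸ Q) •ᵀ  = (Q °ᵀ) ⊸ (P °ᵀ)

  cbase n °ᵀ  = if isBase R n then I else cbase n
  𝟙c °ᵀ       = 𝟘
  (P & Q) °ᵀ  = (P °ᵀ) ⊕ (Q °ᵀ)
  (A ⇒ Q) °ᵀ  = ! (A •ᵀ) ⊗ (Q °ᵀ)
  I °ᵀ        = R
  (! A) °ᵀ    = (A •ᵀ) ⇒ R
  (! A ⊗ Q) °ᵀ = (A •ᵀ) ⇒ (Q °ᵀ)
  𝟘 °ᵀ        = 𝟙c
  (P ⊕ Q) °ᵀ  = (P °ᵀ) & (Q °ᵀ)

  ctx : Ctx → Ctx
  ctx ε       = ε
  ctx (Γ ▸ A) = ctx Γ ▸ (A •ᵀ)

  trVar : Var Γ A → Var (ctx Γ) (A •ᵀ)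
  trVar vz     = vz
  trVar (vs x) = vs (trVar x)

  -- Γ | - ⊢ t : A        ↦  Γ• | - ⊢ t• : A•
  -- Γ | z:D ⊢ t : B      ↦  Γ• | k_z:B° ⊢ t° : D°
  -- (the continuation variable k_z is the stoup variable 'sv'; renamings
  --  of stoup variables such as t°[k/k_x] are the identity here)
  _• : Tm Γ nothing A → Tm (ctx Γ) nothing (A •ᵀ)
  _° : Tm Γ (just D) ⌈ Q ⌉ → Tm (ctx Γ) (just (Q °ᵀ)) ⌈ D °ᵀ ⌉

  var x •         = var (trVar x)
  unit •          = unit
  pair t u •      = pair (t •) (u •)
  fst t •         = fst (t •)
  snd t •         = snd (t •)
  lam t •         = lam (t •)
  app t u •       = app (t •) (u •)
  unitc •         = llam (abort sv)
  pairc t u •     = llam (case sv (lapp (t •) sv) (lapp (u •) sv))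
  fstc t •        = llam (lapp (t •) (inl sv))
  sndc t •        = llam (lapp (t •) (inr sv))
  clam t •        = llam (letTensor sv (lapp (t •) sv))
  capp s t •      = llam (lapp (s •) (tensor (t •) sv))
  top •           = llam sv
  letTop t u •    = llam (lapp (t •) (lapp (u •) sv))
  bang t •        = llam (capp sv (t •))
  letBang t u •   = llam (lapp (t •) (clam (lapp (u •) sv)))
  tensor t u •    = llam (lapp (u •) (capp sv (t •)))
  letTensor s t • = llam (lapp (s •) (clam (t °)))
  abort t •       = llam (lapp (t •) unitc)
  inl t •         = llam (lapp (t •) (fstc sv))
  inr t •         = llam (lapp (t •) (sndc sv))
  case s t u •    = llam (lapp (s •) (pairc (t °) (u °)))
  llam t •        = llam (t °)
  lapp s t •      = llam (lapp (t •) (lapp (s •) sv))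

  sv °              = sv
  unitc °           = abort sv
  pairc t u °       = case sv (t °) (u °)
  fstc t °          = ssub (t °) (inl sv)
  sndc t °          = ssub (t °) (inr sv)
  clam t °          = letTensor sv (t °)
  capp s t °        = ssub (s °) (tensor (t •) sv)
  letTop t u °      = ssub (t °) (lapp (u •) sv)
  letBang t u °     = ssub (t °) (clam (lapp (u •) sv))
  tensor t u °      = ssub (u °) (capp sv (t •))
  letTensor s t °   = ssub (s °) (clam (t °))
  abort t °         = ssub (t °) unitc
  inl t °           = ssub (t °) (fstc sv)
  inr t °           = ssub (t °) (sndc sv)
  case s t u °      = ssub (s °) (pairc (t °) (u °))
  lapp s t °        = ssub (t °) (lapp (s •) sv)

module Submission where

-- Parts (1) and (2), substitution of a value for a value variable, hold up to
-- syntactic identity: the translation commutes with every renaming and then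
-- with every value substitution σ (using the pointwise translation of σ on
-- the target side), by mutual induction on terms.  This rests on the usual
-- fusion laws of renaming/substitution and on the fact that stoup
-- substitution commutes with them.
--
-- Parts (3) and (4), substitution for the stoup variable, hold only up to the
-- equational theory ≈.  The proof is by induction on the linear term t: when
-- the stoup variable of t sits inside an evaluation frame, t° plugs a frame
-- continuation K into the translation of the subterm, so we prove the
-- statements for an arbitrary continuation K, using β-⊸ and associativity of
-- stoup substitution.  When the stoup variable is the scrutinee of abort,
-- case or let !x⊗y, we need commuting conversions, derived from the η-laws of
-- 𝟘, ⊕ and !A⊗B.

open import Defs
open import Data.Product using (_×_; _,_)
open import Data.Maybe using (just; nothing)
open import Relation.Binary.Bundles using (Setoid)
open import Relation.Binary.PropositionalEquality
  using (_≡_; refl; sym; trans; cong; cong₂)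
import Relation.Binary.Reasoning.Setoid as SetoidReasoning

variable
  Ξ : Ctx

cong₃ : ∀ {a b c d} {X : Set a} {Y : Set b} {Z : Set c} {W : Set d}
        (f : X → Y → Z → W) {x x' y y' z z'}
      → x ≡ x' → y ≡ y' → z ≡ z' → f x y z ≡ f x' y' z'
cong₃ f refl refl refl = refl

-- Fusion laws for renaming and value substitution.  Each is stated for
-- arbitrary maps that agree pointwise, so that it can pass under binders.

liftR-ren-ren : {ρ₁ : Ren Θ Ξ} {ρ₂ : Ren Γ Θ} {ρ₃ : Ren Γ Ξ}
              → (∀ {A} (x : Var Γ A) → ρ₁ (ρ₂ x) ≡ ρ₃ x)
              → ∀ {A} (x : Var (Γ ▸ B) A) → liftR ρ₁ (liftR ρ₂ x) ≡ liftR ρ₃ x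
liftR-ren-ren h vz     = refl
liftR-ren-ren h (vs x) = cong vs (h x)

ren-ren : {ρ₁ : Ren Θ Ξ} {ρ₂ : Ren Γ Θ} {ρ₃ : Ren Γ Ξ}
        → (∀ {A} (x : Var Γ A) → ρ₁ (ρ₂ x) ≡ ρ₃ x)
        → (t : Tm Γ Δ A) → ren ρ₁ (ren ρ₂ t) ≡ ren ρ₃ t
ren-ren h (var x)         = cong var (h x)
ren-ren h unit            = refl
ren-ren h (pair a b)      = cong₂ pair (ren-ren h a) (ren-ren h b)
ren-ren h (fst a)         = cong fst (ren-ren h a)
ren-ren h (snd a)         = cong snd (ren-ren h a)
ren-ren h (lam a)         = cong lam (ren-ren (liftR-ren-ren h) a)
ren-ren h (app a b)       = cong₂ app (ren-ren h a) (ren-ren h b)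
ren-ren h sv              = refl
ren-ren h unitc           = refl
ren-ren h (pairc a b)     = cong₂ pairc (ren-ren h a) (ren-ren h b)
ren-ren h (fstc a)        = cong fstc (ren-ren h a)
ren-ren h (sndc a)        = cong sndc (ren-ren h a)
ren-ren h (clam a)        = cong clam (ren-ren (liftR-ren-ren h) a)
ren-ren h (capp a b)      = cong₂ capp (ren-ren h a) (ren-ren h b)
ren-ren h top             = refl
ren-ren h (letTop a b)    = cong₂ letTop (ren-ren h a) (ren-ren h b)
ren-ren h (bang a)        = cong bang (ren-ren h a)
ren-ren h (letBang a b)   = cong₂ letBang (ren-ren h a) (ren-ren (liftR-ren-ren h) b)
ren-ren h (tensor a b)    = cong₂ tensor (ren-ren h a) (ren-ren h b)
ren-ren h (letTensor a b) = cong₂ letTensor (ren-ren h a) (ren-ren (liftR-ren-ren h) b)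
ren-ren h (abort a)       = cong abort (ren-ren h a)
ren-ren h (inl a)         = cong inl (ren-ren h a)
ren-ren h (inr a)         = cong inr (ren-ren h a)
ren-ren h (case a b c)    = cong₃ case (ren-ren h a) (ren-ren h b) (ren-ren h c)
ren-ren h (llam a)        = cong llam (ren-ren h a)
ren-ren h (lapp a b)      = cong₂ lapp (ren-ren h a) (ren-ren h b)

ren-wk : {ρ : Ren Γ Θ} (t : Tm Γ Δ A) → ren (liftR {B = B} ρ) (wk t) ≡ wk (ren ρ t)
ren-wk t = trans (ren-ren (λ _ → refl) t) (sym (ren-ren (λ _ → refl) t))

liftS-ren-sub : {ρ : Ren Θ Ξ} {σ : Sub Γ Θ} {σ' : Sub Γ Ξ}
              → (∀ {A} (x : Var Γ A) → ren ρ (σ x) ≡ σ' x)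
              → ∀ {A} (x : Var (Γ ▸ B) A) → ren (liftR ρ) (liftS σ x) ≡ liftS σ' x
liftS-ren-sub h vz                 = refl
liftS-ren-sub {σ = σ} h (vs x) = trans (ren-wk (σ x)) (cong wk (h x))

ren-sub : {ρ : Ren Θ Ξ} {σ : Sub Γ Θ} {σ' : Sub Γ Ξ}
        → (∀ {A} (x : Var Γ A) → ren ρ (σ x) ≡ σ' x)
        → (t : Tm Γ Δ A) → ren ρ (sub σ t) ≡ sub σ' t
ren-sub h (var x)         = h x
ren-sub h unit            = refl
ren-sub h (pair a b)      = cong₂ pair (ren-sub h a) (ren-sub h b)
ren-sub h (fst a)         = cong fst (ren-sub h a)
ren-sub h (snd a)         = cong snd (ren-sub h a)
ren-sub h (lam a)         = cong lam (ren-sub (liftS-ren-sub h) a)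
ren-sub h (app a b)       = cong₂ app (ren-sub h a) (ren-sub h b)
ren-sub h sv              = refl
ren-sub h unitc           = refl
ren-sub h (pairc a b)     = cong₂ pairc (ren-sub h a) (ren-sub h b)
ren-sub h (fstc a)        = cong fstc (ren-sub h a)
ren-sub h (sndc a)        = cong sndc (ren-sub h a)
ren-sub h (clam a)        = cong clam (ren-sub (liftS-ren-sub h) a)
ren-sub h (capp a b)      = cong₂ capp (ren-sub h a) (ren-sub h b)
ren-sub h top             = refl
ren-sub h (letTop a b)    = cong₂ letTop (ren-sub h a) (ren-sub h b)
ren-sub h (bang a)        = cong bang (ren-sub h a)
ren-sub h (letBang a b)   = cong₂ letBang (ren-sub h a) (ren-sub (liftS-ren-sub h) b)
ren-sub h (tensor a b)    = cong₂ tensor (ren-sub h a) (ren-sub h b)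
ren-sub h (letTensor a b) = cong₂ letTensor (ren-sub h a) (ren-sub (liftS-ren-sub h) b)
ren-sub h (abort a)       = cong abort (ren-sub h a)
ren-sub h (inl a)         = cong inl (ren-sub h a)
ren-sub h (inr a)         = cong inr (ren-sub h a)
ren-sub h (case a b c)    = cong₃ case (ren-sub h a) (ren-sub h b) (ren-sub h c)
ren-sub h (llam a)        = cong llam (ren-sub h a)
ren-sub h (lapp a b)      = cong₂ lapp (ren-sub h a) (ren-sub h b)

liftS-sub-ren : {σ : Sub Θ Ξ} {ρ : Ren Γ Θ} {σ' : Sub Γ Ξ}
              → (∀ {A} (x : Var Γ A) → σ (ρ x) ≡ σ' x)
              → ∀ {A} (x : Var (Γ ▸ B) A) → liftS σ (liftR ρ x) ≡ liftS σ' x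
liftS-sub-ren h vz     = refl
liftS-sub-ren h (vs x) = cong wk (h x)

sub-ren : {σ : Sub Θ Ξ} {ρ : Ren Γ Θ} {σ' : Sub Γ Ξ}
        → (∀ {A} (x : Var Γ A) → σ (ρ x) ≡ σ' x)
        → (t : Tm Γ Δ A) → sub σ (ren ρ t) ≡ sub σ' t
sub-ren h (var x)         = h x
sub-ren h unit            = refl
sub-ren h (pair a b)      = cong₂ pair (sub-ren h a) (sub-ren h b)
sub-ren h (fst a)         = cong fst (sub-ren h a)
sub-ren h (snd a)         = cong snd (sub-ren h a)
sub-ren h (lam a)         = cong lam (sub-ren (liftS-sub-ren h) a)
sub-ren h (app a b)       = cong₂ app (sub-ren h a) (sub-ren h b)
sub-ren h sv              = refl
sub-ren h unitc           = refl
sub-ren h (pairc a b)     = cong₂ pairc (sub-ren h a) (sub-ren h b)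
sub-ren h (fstc a)        = cong fstc (sub-ren h a)
sub-ren h (sndc a)        = cong sndc (sub-ren h a)
sub-ren h (clam a)        = cong clam (sub-ren (liftS-sub-ren h) a)
sub-ren h (capp a b)      = cong₂ capp (sub-ren h a) (sub-ren h b)
sub-ren h top             = refl
sub-ren h (letTop a b)    = cong₂ letTop (sub-ren h a) (sub-ren h b)
sub-ren h (bang a)        = cong bang (sub-ren h a)
sub-ren h (letBang a b)   = cong₂ letBang (sub-ren h a) (sub-ren (liftS-sub-ren h) b)
sub-ren h (tensor a b)    = cong₂ tensor (sub-ren h a) (sub-ren h b)
sub-ren h (letTensor a b) = cong₂ letTensor (sub-ren h a) (sub-ren (liftS-sub-ren h) b)
sub-ren h (abort a)       = cong abort (sub-ren h a)
sub-ren h (inl a)         = cong inl (sub-ren h a)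
sub-ren h (inr a)         = cong inr (sub-ren h a)
sub-ren h (case a b c)    = cong₃ case (sub-ren h a) (sub-ren h b) (sub-ren h c)
sub-ren h (llam a)        = cong llam (sub-ren h a)
sub-ren h (lapp a b)      = cong₂ lapp (sub-ren h a) (sub-ren h b)

sub-wk : {σ : Sub Γ Θ} (t : Tm Γ Δ A) → sub (liftS {B = B} σ) (wk t) ≡ wk (sub σ t)
sub-wk t = trans (sub-ren (λ _ → refl) t) (sym (ren-sub (λ _ → refl) t))

liftS-id : {σ : Sub Γ Γ} → (∀ {A} (x : Var Γ A) → σ x ≡ var x)
         → ∀ {A} (x : Var (Γ ▸ B) A) → liftS σ x ≡ var x
liftS-id h vz     = refl
liftS-id h (vs x) = cong wk (h x)

sub-id : {σ : Sub Γ Γ} → (∀ {A} (x : Var Γ A) → σ x ≡ var x)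
       → (t : Tm Γ Δ A) → sub σ t ≡ t
sub-id h (var x)         = h x
sub-id h unit            = refl
sub-id h (pair a b)      = cong₂ pair (sub-id h a) (sub-id h b)
sub-id h (fst a)         = cong fst (sub-id h a)
sub-id h (snd a)         = cong snd (sub-id h a)
sub-id h (lam a)         = cong lam (sub-id (liftS-id h) a)
sub-id h (app a b)       = cong₂ app (sub-id h a) (sub-id h b)
sub-id h sv              = refl
sub-id h unitc           = refl
sub-id h (pairc a b)     = cong₂ pairc (sub-id h a) (sub-id h b)
sub-id h (fstc a)        = cong fstc (sub-id h a)
sub-id h (sndc a)        = cong sndc (sub-id h a)
sub-id h (clam a)        = cong clam (sub-id (liftS-id h) a)
sub-id h (capp a b)      = cong₂ capp (sub-id h a) (sub-id h b)
sub-id h top             = refl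
sub-id h (letTop a b)    = cong₂ letTop (sub-id h a) (sub-id h b)
sub-id h (bang a)        = cong bang (sub-id h a)
sub-id h (letBang a b)   = cong₂ letBang (sub-id h a) (sub-id (liftS-id h) b)
sub-id h (tensor a b)    = cong₂ tensor (sub-id h a) (sub-id h b)
sub-id h (letTensor a b) = cong₂ letTensor (sub-id h a) (sub-id (liftS-id h) b)
sub-id h (abort a)       = cong abort (sub-id h a)
sub-id h (inl a)         = cong inl (sub-id h a)
sub-id h (inr a)         = cong inr (sub-id h a)
sub-id h (case a b c)    = cong₃ case (sub-id h a) (sub-id h b) (sub-id h c)
sub-id h (llam a)        = cong llam (sub-id h a)
sub-id h (lapp a b)      = cong₂ lapp (sub-id h a) (sub-id h b)

wk-under-inst : (b : Tm (Γ ▸ A) Δ B) → (ren (liftR {B = A} vs) b) [ var vz ]₀ ≡ b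
wk-under-inst b =
  trans (sub-ren {σ' = var} (λ { vz → refl ; (vs x) → refl }) b) (sub-id (λ _ → refl) b)

ren-ssub : (ρ : Ren Γ Θ) (t : Tm Γ (just P) A) (u : Tm Γ Δ ⌈ P ⌉)
         → ren ρ (ssub t u) ≡ ssub (ren ρ t) (ren ρ u)
ren-ssub ρ sv              u = refl
ren-ssub ρ unitc           u = refl
ren-ssub ρ (pairc t t')    u = cong₂ pairc (ren-ssub ρ t u) (ren-ssub ρ t' u)
ren-ssub ρ (fstc t)        u = cong fstc (ren-ssub ρ t u)
ren-ssub ρ (sndc t)        u = cong sndc (ren-ssub ρ t u)
ren-ssub ρ (clam t)        u =
  cong clam (trans (ren-ssub (liftR ρ) t (wk u)) (cong (ssub (ren (liftR ρ) t)) (ren-wk u)))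
ren-ssub ρ (capp t v)      u = cong (λ a → capp a (ren ρ v)) (ren-ssub ρ t u)
ren-ssub ρ (letTop t v)    u = cong (λ a → letTop a (ren ρ v)) (ren-ssub ρ t u)
ren-ssub ρ (letBang t v)   u = cong (λ a → letBang a (ren (liftR ρ) v)) (ren-ssub ρ t u)
ren-ssub ρ (tensor v t)    u = cong (tensor (ren ρ v)) (ren-ssub ρ t u)
ren-ssub ρ (letTensor s t) u = cong (λ a → letTensor a (ren (liftR ρ) t)) (ren-ssub ρ s u)
ren-ssub ρ (abort t)       u = cong abort (ren-ssub ρ t u)
ren-ssub ρ (inl t)         u = cong inl (ren-ssub ρ t u)
ren-ssub ρ (inr t)         u = cong inr (ren-ssub ρ t u)
ren-ssub ρ (case s t t')   u = cong (λ a → case a (ren ρ t) (ren ρ t')) (ren-ssub ρ s u)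
ren-ssub ρ (lapp s t)      u = cong (lapp (ren ρ s)) (ren-ssub ρ t u)

sub-ssub : (σ : Sub Γ Θ) (t : Tm Γ (just P) A) (u : Tm Γ Δ ⌈ P ⌉)
         → sub σ (ssub t u) ≡ ssub (sub σ t) (sub σ u)
sub-ssub σ sv              u = refl
sub-ssub σ unitc           u = refl
sub-ssub σ (pairc t t')    u = cong₂ pairc (sub-ssub σ t u) (sub-ssub σ t' u)
sub-ssub σ (fstc t)        u = cong fstc (sub-ssub σ t u)
sub-ssub σ (sndc t)        u = cong sndc (sub-ssub σ t u)
sub-ssub σ (clam t)        u =
  cong clam (trans (sub-ssub (liftS σ) t (wk u)) (cong (ssub (sub (liftS σ) t)) (sub-wk u)))
sub-ssub σ (capp t v)      u = cong (λ a → capp a (sub σ v)) (sub-ssub σ t u)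
sub-ssub σ (letTop t v)    u = cong (λ a → letTop a (sub σ v)) (sub-ssub σ t u)
sub-ssub σ (letBang t v)   u = cong (λ a → letBang a (sub (liftS σ) v)) (sub-ssub σ t u)
sub-ssub σ (tensor v t)    u = cong (tensor (sub σ v)) (sub-ssub σ t u)
sub-ssub σ (letTensor s t) u = cong (λ a → letTensor a (sub (liftS σ) t)) (sub-ssub σ s u)
sub-ssub σ (abort t)       u = cong abort (sub-ssub σ t u)
sub-ssub σ (inl t)         u = cong inl (sub-ssub σ t u)
sub-ssub σ (inr t)         u = cong inr (sub-ssub σ t u)
sub-ssub σ (case s t t')   u = cong (λ a → case a (sub σ t) (sub σ t')) (sub-ssub σ s u)
sub-ssub σ (lapp s t)      u = cong (lapp (sub σ s)) (sub-ssub σ t u)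

ssub-assoc : (a : Tm Γ (just P) A) (b : Tm Γ (just Q) ⌈ P ⌉) (c : Tm Γ Δ ⌈ Q ⌉)
           → ssub (ssub a b) c ≡ ssub a (ssub b c)
ssub-assoc sv              b c = refl
ssub-assoc unitc           b c = refl
ssub-assoc (pairc t t')    b c = cong₂ pairc (ssub-assoc t b c) (ssub-assoc t' b c)
ssub-assoc (fstc t)        b c = cong fstc (ssub-assoc t b c)
ssub-assoc (sndc t)        b c = cong sndc (ssub-assoc t b c)
ssub-assoc (clam t)        b c =
  cong clam (trans (ssub-assoc t (wk b) (wk c)) (cong (ssub t) (sym (ren-ssub vs b c))))
ssub-assoc (capp t v)      b c = cong (λ a → capp a v) (ssub-assoc t b c)
ssub-assoc (letTop t v)    b c = cong (λ a → letTop a v) (ssub-assoc t b c)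
ssub-assoc (letBang t v)   b c = cong (λ a → letBang a v) (ssub-assoc t b c)
ssub-assoc (tensor v t)    b c = cong (tensor v) (ssub-assoc t b c)
ssub-assoc (letTensor s t) b c = cong (λ a → letTensor a t) (ssub-assoc s b c)
ssub-assoc (abort t)       b c = cong abort (ssub-assoc t b c)
ssub-assoc (inl t)         b c = cong inl (ssub-assoc t b c)
ssub-assoc (inr t)         b c = cong inr (ssub-assoc t b c)
ssub-assoc (case s t t')   b c = cong (λ a → case a t t') (ssub-assoc s b c)
ssub-assoc (lapp s t)      b c = cong (lapp s) (ssub-assoc t b c)

ssub-sv : (t : Tm Γ (just P) A) → ssub t sv ≡ t
ssub-sv sv              = refl
ssub-sv unitc           = refl
ssub-sv (pairc t t')    = cong₂ pairc (ssub-sv t) (ssub-sv t')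
ssub-sv (fstc t)        = cong fstc (ssub-sv t)
ssub-sv (sndc t)        = cong sndc (ssub-sv t)
ssub-sv (clam t)        = cong clam (ssub-sv t)
ssub-sv (capp t v)      = cong (λ a → capp a v) (ssub-sv t)
ssub-sv (letTop t v)    = cong (λ a → letTop a v) (ssub-sv t)
ssub-sv (letBang t v)   = cong (λ a → letBang a v) (ssub-sv t)
ssub-sv (tensor v t)    = cong (tensor v) (ssub-sv t)
ssub-sv (letTensor s t) = cong (λ a → letTensor a t) (ssub-sv s)
ssub-sv (abort t)       = cong abort (ssub-sv t)
ssub-sv (inl t)         = cong inl (ssub-sv t)
ssub-sv (inr t)         = cong inr (ssub-sv t)
ssub-sv (case s t t')   = cong (λ a → case a t t') (ssub-sv s)
ssub-sv (lapp s t)      = cong (lapp s) (ssub-sv t)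

-- ren-ssub and sub-ssub read backwards, up to equal components: the form in
-- which the °-clauses of the translation meet renaming and substitution.
ssub-ren-cong : (ρ : Ren Γ Θ) (a : Tm Γ (just P) A) (b : Tm Γ Δ ⌈ P ⌉)
                {a' : Tm Θ (just P) A} {b' : Tm Θ Δ ⌈ P ⌉}
              → a' ≡ ren ρ a → b' ≡ ren ρ b → ssub a' b' ≡ ren ρ (ssub a b)
ssub-ren-cong ρ a b refl refl = sym (ren-ssub ρ a b)

ssub-sub-cong : (σ : Sub Γ Θ) (a : Tm Γ (just P) A) (b : Tm Γ Δ ⌈ P ⌉)
                {a' : Tm Θ (just P) A} {b' : Tm Θ Δ ⌈ P ⌉}
              → a' ≡ sub σ a → b' ≡ sub σ b → ssub a' b' ≡ sub σ (ssub a b)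
ssub-sub-cong σ a b refl refl = sym (sub-ssub σ a b)

≈-setoid : Ctx → Stoup → VTy → Setoid _ _
≈-setoid Γ Δ A = record
  { Carrier       = Tm Γ Δ A
  ; _≈_           = _≈_
  ; isEquivalence = record { refl = ≈-refl ; sym = ≈-sym ; trans = ≈-trans }
  }

module ≈-Reasoning {Γ Δ A} = SetoidReasoning (≈-setoid Γ Δ A)
open ≈-Reasoning

≡⇒≈ : {t u : Tm Γ Δ A} → t ≡ u → t ≈ u
≡⇒≈ refl = ≈-refl

-- Stoup substitution is not a term former, yet it respects ≈ in both
-- arguments: it is the β-reduct of a linear application.
ssub-congˡ : {a a' : Tm Γ (just P) ⌈ Q ⌉} (b : Tm Γ Δ ⌈ P ⌉) → a ≈ a' → ssub a b ≈ ssub a' b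
ssub-congˡ {a = a} {a'} b a≈a' = begin
  ssub a b           ≈⟨ β-⊸ a b ⟨
  lapp (llam a) b    ≈⟨ c-lapp (c-llam a≈a') ≈-refl ⟩
  lapp (llam a') b   ≈⟨ β-⊸ a' b ⟩
  ssub a' b          ∎

ssub-congʳ : (a : Tm Γ (just P) ⌈ Q ⌉) {b b' : Tm Γ Δ ⌈ P ⌉} → b ≈ b' → ssub a b ≈ ssub a b'
ssub-congʳ a {b} {b'} b≈b' = begin
  ssub a b           ≈⟨ β-⊸ a b ⟨
  lapp (llam a) b    ≈⟨ c-lapp ≈-refl b≈b' ⟩
  lapp (llam a) b'   ≈⟨ β-⊸ a b' ⟩
  ssub a b'          ∎

-- Commuting conversions: a linear term w applied to an eliminator of 𝟘, ⊕
-- or !A⊗B may be pushed into the branches.  Each follows from the η-law of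
-- the type, instantiated with the linear term  w[elim(z)/z].

comm-abort : (w : Tm Γ (just P) ⌈ Q ⌉) (s : Tm Γ Δ ⌈ 𝟘 ⌉) → ssub w (abort s) ≈ abort s
comm-abort w s = begin
  ssub w (abort s)              ≡⟨ ssub-assoc w (abort sv) s ⟨
  ssub (ssub w (abort sv)) s    ≈⟨ η-𝟘 (ssub w (abort sv)) s ⟨
  abort s                       ∎

comm-case : (w : Tm Γ (just S) ⌈ D ⌉) (s : Tm Γ Δ ⌈ P ⊕ Q ⌉)
            (a : Tm Γ (just P) ⌈ S ⌉) (b : Tm Γ (just Q) ⌈ S ⌉)
          → ssub w (case s a b) ≈ case s (ssub w a) (ssub w b)
comm-case w s a b = begin
  ssub w (case s a b)                          ≡⟨ ssub-assoc w (case sv a b) s ⟨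
  ssub W s                                     ≈⟨ η-⊕ W s ⟨
  case s (ssub W (inl sv)) (ssub W (inr sv))   ≈⟨ c-case ≈-refl left right ⟩
  case s (ssub w a) (ssub w b)                 ∎
  where
  W : Tm _ (just (_ ⊕ _)) ⌈ _ ⌉
  W = ssub w (case sv a b)
  left : ssub W (inl sv) ≈ ssub w a
  left = begin
    ssub W (inl sv)               ≡⟨ ssub-assoc w (case sv a b) (inl sv) ⟩
    ssub w (case (inl sv) a b)    ≈⟨ ssub-congʳ w (β-inl sv a b) ⟩
    ssub w (ssub a sv)            ≡⟨ cong (ssub w) (ssub-sv a) ⟩
    ssub w a                      ∎
  right : ssub W (inr sv) ≈ ssub w b
  right = begin
    ssub W (inr sv)               ≡⟨ ssub-assoc w (case sv a b) (inr sv) ⟩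
    ssub w (case (inr sv) a b)    ≈⟨ ssub-congʳ w (β-inr sv a b) ⟩
    ssub w (ssub b sv)            ≡⟨ cong (ssub w) (ssub-sv b) ⟩
    ssub w b                      ∎

comm-letTensor : (w : Tm Γ (just S) ⌈ D ⌉) (s : Tm Γ Δ ⌈ ! A ⊗ Q ⌉) (b : Tm (Γ ▸ A) (just Q) ⌈ S ⌉)
               → ssub w (letTensor s b) ≈ letTensor s (ssub (wk w) b)
comm-letTensor w s b = begin
  ssub w (letTensor s b)                           ≡⟨ ssub-assoc w (letTensor sv b) s ⟨
  ssub W s                                         ≈⟨ η-⊗ W s ⟨
  letTensor s (ssub (wk W) (tensor (var vz) sv))   ≈⟨ c-letTensor ≈-refl body ⟩
  letTensor s (ssub (wk w) b)                      ∎
  where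
  W : Tm _ (just (! _ ⊗ _)) ⌈ _ ⌉
  W = ssub w (letTensor sv b)
  b' : Tm (_ ▸ _ ▸ _) (just _) ⌈ _ ⌉
  b' = ren (liftR vs) b
  body : ssub (wk W) (tensor (var vz) sv) ≈ ssub (wk w) b
  body = begin
    ssub (wk W) (tensor (var vz) sv)
      ≡⟨ cong (λ v → ssub v (tensor (var vz) sv)) (ren-ssub vs w (letTensor sv b)) ⟩
    ssub (ssub (wk w) (letTensor sv b')) (tensor (var vz) sv)
      ≡⟨ ssub-assoc (wk w) (letTensor sv b') (tensor (var vz) sv) ⟩
    ssub (wk w) (letTensor (tensor (var vz) sv) b')
      ≈⟨ ssub-congʳ (wk w) (β-⊗ (var vz) sv b') ⟩
    ssub (wk w) (ssub (b' [ var vz ]₀) sv)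
      ≡⟨ cong (ssub (wk w)) (trans (ssub-sv (b' [ var vz ]₀)) (wk-under-inst b)) ⟩
    ssub (wk w) b
      ∎

module Translation (R : CTy) where
  open Trans R

  RenTracks : Ren Γ Θ → Ren (ctx Γ) (ctx Θ) → Set
  RenTracks {Γ} ρ ρ' = ∀ {A} (x : Var Γ A) → ρ' (trVar x) ≡ trVar (ρ x)

  liftR-tracks : {ρ : Ren Γ Θ} {ρ' : Ren (ctx Γ) (ctx Θ)}
               → RenTracks ρ ρ' → RenTracks (liftR {B = B} ρ) (liftR ρ')
  liftR-tracks h vz     = refl
  liftR-tracks h (vs x) = cong vs (h x)

  ren• : {ρ : Ren Γ Θ} (ρ' : Ren (ctx Γ) (ctx Θ)) → RenTracks ρ ρ'
       → (t : Tm Γ nothing A) → (ren ρ t) • ≡ ren ρ' (t •)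
  ren° : {ρ : Ren Γ Θ} (ρ' : Ren (ctx Γ) (ctx Θ)) → RenTracks ρ ρ'
       → (t : Tm Γ (just D) ⌈ Q ⌉) → (ren ρ t) ° ≡ ren ρ' (t °)

  ren• ρ' h (var x)         = cong var (sym (h x))
  ren• ρ' h unit            = refl
  ren• ρ' h (pair t u)      = cong₂ pair (ren• ρ' h t) (ren• ρ' h u)
  ren• ρ' h (fst t)         = cong fst (ren• ρ' h t)
  ren• ρ' h (snd t)         = cong snd (ren• ρ' h t)
  ren• ρ' h (lam t)         = cong lam (ren• (liftR ρ') (liftR-tracks h) t)
  ren• ρ' h (app t u)       = cong₂ app (ren• ρ' h t) (ren• ρ' h u)
  ren• ρ' h unitc           = refl
  ren• ρ' h (pairc t u) =
    cong₂ (λ a b → llam (case sv (lapp a sv) (lapp b sv))) (ren• ρ' h t) (ren• ρ' h u)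
  ren• ρ' h (fstc t)        = cong (λ a → llam (lapp a (inl sv))) (ren• ρ' h t)
  ren• ρ' h (sndc t)        = cong (λ a → llam (lapp a (inr sv))) (ren• ρ' h t)
  ren• ρ' h (clam t) =
    cong (λ a → llam (letTensor sv (lapp a sv))) (ren• (liftR ρ') (liftR-tracks h) t)
  ren• ρ' h (capp s t)      = cong₂ (λ a b → llam (lapp a (tensor b sv))) (ren• ρ' h s) (ren• ρ' h t)
  ren• ρ' h top             = refl
  ren• ρ' h (letTop t u)    = cong₂ (λ a b → llam (lapp a (lapp b sv))) (ren• ρ' h t) (ren• ρ' h u)
  ren• ρ' h (bang t)        = cong (λ a → llam (capp sv a)) (ren• ρ' h t)
  ren• ρ' h (letBang t u) =
    cong₂ (λ a b → llam (lapp a (clam (lapp b sv)))) (ren• ρ' h t) (ren• (liftR ρ') (liftR-tracks h) u)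
  ren• ρ' h (tensor t u)    = cong₂ (λ a b → llam (lapp b (capp sv a))) (ren• ρ' h t) (ren• ρ' h u)
  ren• ρ' h (letTensor s t) =
    cong₂ (λ a b → llam (lapp a (clam b))) (ren• ρ' h s) (ren° (liftR ρ') (liftR-tracks h) t)
  ren• ρ' h (abort t)       = cong (λ a → llam (lapp a unitc)) (ren• ρ' h t)
  ren• ρ' h (inl t)         = cong (λ a → llam (lapp a (fstc sv))) (ren• ρ' h t)
  ren• ρ' h (inr t)         = cong (λ a → llam (lapp a (sndc sv))) (ren• ρ' h t)
  ren• ρ' h (case s t u) =
    cong₃ (λ a b c → llam (lapp a (pairc b c))) (ren• ρ' h s) (ren° ρ' h t) (ren° ρ' h u)
  ren• ρ' h (llam t)        = cong llam (ren° ρ' h t)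
  ren• ρ' h (lapp s t)      = cong₂ (λ a b → llam (lapp b (lapp a sv))) (ren• ρ' h s) (ren• ρ' h t)

  ren° ρ' h sv              = refl
  ren° ρ' h unitc           = refl
  ren° ρ' h (pairc t u)     = cong₂ (case sv) (ren° ρ' h t) (ren° ρ' h u)
  ren° ρ' h (fstc t)        = ssub-ren-cong ρ' (t °) (inl sv) (ren° ρ' h t) refl
  ren° ρ' h (sndc t)        = ssub-ren-cong ρ' (t °) (inr sv) (ren° ρ' h t) refl
  ren° ρ' h (clam t)        = cong (letTensor sv) (ren° (liftR ρ') (liftR-tracks h) t)
  ren° ρ' h (capp s t) =
    ssub-ren-cong ρ' (s °) (tensor (t •) sv) (ren° ρ' h s) (cong (λ b → tensor b sv) (ren• ρ' h t))
  ren° ρ' h (letTop t u) =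
    ssub-ren-cong ρ' (t °) (lapp (u •) sv) (ren° ρ' h t) (cong (λ b → lapp b sv) (ren• ρ' h u))
  ren° ρ' h (letBang t u) =
    ssub-ren-cong ρ' (t °) (clam (lapp (u •) sv)) (ren° ρ' h t)
      (cong (λ b → clam (lapp b sv)) (ren• (liftR ρ') (liftR-tracks h) u))
  ren° ρ' h (tensor t u) =
    ssub-ren-cong ρ' (u °) (capp sv (t •)) (ren° ρ' h u) (cong (capp sv) (ren• ρ' h t))
  ren° ρ' h (letTensor s t) =
    ssub-ren-cong ρ' (s °) (clam (t °)) (ren° ρ' h s) (cong clam (ren° (liftR ρ') (liftR-tracks h) t))
  ren° ρ' h (abort t)       = ssub-ren-cong ρ' (t °) (unitc) (ren° ρ' h t) refl
  ren° ρ' h (inl t)         = ssub-ren-cong ρ' (t °) (fstc sv) (ren° ρ' h t) refl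
  ren° ρ' h (inr t)         = ssub-ren-cong ρ' (t °) (sndc sv) (ren° ρ' h t) refl
  ren° ρ' h (case s t u) =
    ssub-ren-cong ρ' (s °) (pairc (t °) (u °)) (ren° ρ' h s) (cong₂ pairc (ren° ρ' h t) (ren° ρ' h u))
  ren° ρ' h (lapp s t) =
    ssub-ren-cong ρ' (t °) (lapp (s •) sv) (ren° ρ' h t) (cong (λ a → lapp a sv) (ren• ρ' h s))

  wk• : (t : Tm Γ nothing A) → (wk {B = B} t) • ≡ wk (t •)
  wk• = ren• vs (λ _ → refl)

  wk° : (t : Tm Γ (just D) ⌈ Q ⌉) → (wk {B = B} t) ° ≡ wk (t °)
  wk° = ren° vs (λ _ → refl)

  SubTracks : Sub Γ Θ → Sub (ctx Γ) (ctx Θ) → Set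
  SubTracks {Γ} σ σ' = ∀ {A} (x : Var Γ A) → σ' (trVar x) ≡ (σ x) •

  liftS-tracks : {σ : Sub Γ Θ} {σ' : Sub (ctx Γ) (ctx Θ)}
               → SubTracks σ σ' → SubTracks (liftS {B = B} σ) (liftS σ')
  liftS-tracks h vz                 = refl
  liftS-tracks {σ = σ} h (vs x) = trans (cong wk (h x)) (sym (wk• (σ x)))

  sub• : {σ : Sub Γ Θ} (σ' : Sub (ctx Γ) (ctx Θ)) → SubTracks σ σ'
       → (t : Tm Γ nothing A) → (sub σ t) • ≡ sub σ' (t •)
  sub° : {σ : Sub Γ Θ} (σ' : Sub (ctx Γ) (ctx Θ)) → SubTracks σ σ'
       → (t : Tm Γ (just D) ⌈ Q ⌉) → (sub σ t) ° ≡ sub σ' (t °)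

  sub• σ' h (var x)         = sym (h x)
  sub• σ' h unit            = refl
  sub• σ' h (pair t u)      = cong₂ pair (sub• σ' h t) (sub• σ' h u)
  sub• σ' h (fst t)         = cong fst (sub• σ' h t)
  sub• σ' h (snd t)         = cong snd (sub• σ' h t)
  sub• σ' h (lam t)         = cong lam (sub• (liftS σ') (liftS-tracks h) t)
  sub• σ' h (app t u)       = cong₂ app (sub• σ' h t) (sub• σ' h u)
  sub• σ' h unitc           = refl
  sub• σ' h (pairc t u) =
    cong₂ (λ a b → llam (case sv (lapp a sv) (lapp b sv))) (sub• σ' h t) (sub• σ' h u)
  sub• σ' h (fstc t)        = cong (λ a → llam (lapp a (inl sv))) (sub• σ' h t)
  sub• σ' h (sndc t)        = cong (λ a → llam (lapp a (inr sv))) (sub• σ' h t)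
  sub• σ' h (clam t) =
    cong (λ a → llam (letTensor sv (lapp a sv))) (sub• (liftS σ') (liftS-tracks h) t)
  sub• σ' h (capp s t)      = cong₂ (λ a b → llam (lapp a (tensor b sv))) (sub• σ' h s) (sub• σ' h t)
  sub• σ' h top             = refl
  sub• σ' h (letTop t u)    = cong₂ (λ a b → llam (lapp a (lapp b sv))) (sub• σ' h t) (sub• σ' h u)
  sub• σ' h (bang t)        = cong (λ a → llam (capp sv a)) (sub• σ' h t)
  sub• σ' h (letBang t u) =
    cong₂ (λ a b → llam (lapp a (clam (lapp b sv)))) (sub• σ' h t) (sub• (liftS σ') (liftS-tracks h) u)
  sub• σ' h (tensor t u)    = cong₂ (λ a b → llam (lapp b (capp sv a))) (sub• σ' h t) (sub• σ' h u)
  sub• σ' h (letTensor s t) =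
    cong₂ (λ a b → llam (lapp a (clam b))) (sub• σ' h s) (sub° (liftS σ') (liftS-tracks h) t)
  sub• σ' h (abort t)       = cong (λ a → llam (lapp a unitc)) (sub• σ' h t)
  sub• σ' h (inl t)         = cong (λ a → llam (lapp a (fstc sv))) (sub• σ' h t)
  sub• σ' h (inr t)         = cong (λ a → llam (lapp a (sndc sv))) (sub• σ' h t)
  sub• σ' h (case s t u) =
    cong₃ (λ a b c → llam (lapp a (pairc b c))) (sub• σ' h s) (sub° σ' h t) (sub° σ' h u)
  sub• σ' h (llam t)        = cong llam (sub° σ' h t)
  sub• σ' h (lapp s t)      = cong₂ (λ a b → llam (lapp b (lapp a sv))) (sub• σ' h s) (sub• σ' h t)

  sub° σ' h sv              = refl
  sub° σ' h unitc           = refl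
  sub° σ' h (pairc t u)     = cong₂ (case sv) (sub° σ' h t) (sub° σ' h u)
  sub° σ' h (fstc t)        = ssub-sub-cong σ' (t °) (inl sv) (sub° σ' h t) refl
  sub° σ' h (sndc t)        = ssub-sub-cong σ' (t °) (inr sv) (sub° σ' h t) refl
  sub° σ' h (clam t)        = cong (letTensor sv) (sub° (liftS σ') (liftS-tracks h) t)
  sub° σ' h (capp s t) =
    ssub-sub-cong σ' (s °) (tensor (t •) sv) (sub° σ' h s) (cong (λ b → tensor b sv) (sub• σ' h t))
  sub° σ' h (letTop t u) =
    ssub-sub-cong σ' (t °) (lapp (u •) sv) (sub° σ' h t) (cong (λ b → lapp b sv) (sub• σ' h u))
  sub° σ' h (letBang t u) =
    ssub-sub-cong σ' (t °) (clam (lapp (u •) sv)) (sub° σ' h t)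
      (cong (λ b → clam (lapp b sv)) (sub• (liftS σ') (liftS-tracks h) u))
  sub° σ' h (tensor t u) =
    ssub-sub-cong σ' (u °) (capp sv (t •)) (sub° σ' h u) (cong (capp sv) (sub• σ' h t))
  sub° σ' h (letTensor s t) =
    ssub-sub-cong σ' (s °) (clam (t °)) (sub° σ' h s) (cong clam (sub° (liftS σ') (liftS-tracks h) t))
  sub° σ' h (abort t)       = ssub-sub-cong σ' (t °) (unitc) (sub° σ' h t) refl
  sub° σ' h (inl t)         = ssub-sub-cong σ' (t °) (fstc sv) (sub° σ' h t) refl
  sub° σ' h (inr t)         = ssub-sub-cong σ' (t °) (sndc sv) (sub° σ' h t) refl
  sub° σ' h (case s t u) =
    ssub-sub-cong σ' (s °) (pairc (t °) (u °)) (sub° σ' h s) (cong₂ pairc (sub° σ' h t) (sub° σ' h u))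
  sub° σ' h (lapp s t) =
    ssub-sub-cong σ' (t °) (lapp (s •) sv) (sub° σ' h t) (cong (λ a → lapp a sv) (sub• σ' h s))

  sub₀-tracks : (u : Tm Γ nothing A) → SubTracks (sub₀ u) (sub₀ (u •))
  sub₀-tracks u vz     = refl
  sub₀-tracks u (vs x) = refl

  inst• : (t : Tm (Γ ▸ A) nothing B) (u : Tm Γ nothing A) → (t [ u ]₀) • ≈ (t •) [ u • ]₀
  inst• t u = ≡⇒≈ (sub• (sub₀ (u •)) (sub₀-tracks u) t)

  inst° : (t : Tm (Γ ▸ A) (just D) ⌈ Q ⌉) (u : Tm Γ nothing A) → (t [ u ]₀) ° ≈ (t °) [ u • ]₀
  inst° t u = ≡⇒≈ (sub° (sub₀ (u •)) (sub₀-tracks u) t)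

  -- When the stoup variable of t sits in
  -- an evaluation frame, t° is the translation of the subterm with the frame's
  -- continuation K plugged in, and the plugged form is what the induction needs.

  °-ssub-plugged : (t : Tm Γ (just P) ⌈ Q ⌉) (u : Tm Γ (just D) ⌈ P ⌉) (K : Tm (ctx Γ) (just S) ⌈ Q °ᵀ ⌉)
                 → ssub ((ssub t u) °) K ≈ ssub (u °) (ssub (t °) K)
  °-ssub : (t : Tm Γ (just P) ⌈ Q ⌉) (u : Tm Γ (just D) ⌈ P ⌉) → (ssub t u) ° ≈ ssub (u °) (t °)

  °-ssub-plugged t u K = begin
    ssub ((ssub t u) °) K          ≈⟨ ssub-congˡ K (°-ssub t u) ⟩
    ssub (ssub (u °) (t °)) K      ≡⟨ ssub-assoc (u °) (t °) K ⟩
    ssub (u °) (ssub (t °) K)      ∎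

  °-ssub sv              u = ≡⇒≈ (sym (ssub-sv (u °)))
  °-ssub unitc           u = ≈-sym (comm-abort (u °) sv)
  °-ssub (pairc t t')    u = begin
    case sv ((ssub t u) °) ((ssub t' u) °)        ≈⟨ c-case ≈-refl (°-ssub t u) (°-ssub t' u) ⟩
    case sv (ssub (u °) (t °)) (ssub (u °) (t' °)) ≈⟨ comm-case (u °) sv (t °) (t' °) ⟨
    ssub (u °) (case sv (t °) (t' °))             ∎
  °-ssub (clam t)        u = begin
    letTensor sv ((ssub t (wk u)) °)              ≈⟨ c-letTensor ≈-refl (°-ssub t (wk u)) ⟩
    letTensor sv (ssub ((wk u) °) (t °))          ≡⟨ cong (λ a → letTensor sv (ssub a (t °))) (wk° u) ⟩
    letTensor sv (ssub (wk (u °)) (t °))          ≈⟨ comm-letTensor (u °) sv (t °) ⟨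
    ssub (u °) (letTensor sv (t °))               ∎
  °-ssub (fstc t)        u = °-ssub-plugged t u (inl sv)
  °-ssub (sndc t)        u = °-ssub-plugged t u (inr sv)
  °-ssub (capp t v)      u = °-ssub-plugged t u (tensor (v •) sv)
  °-ssub (letTop t v)    u = °-ssub-plugged t u (lapp (v •) sv)
  °-ssub (letBang t v)   u = °-ssub-plugged t u (clam (lapp (v •) sv))
  °-ssub (tensor v t)    u = °-ssub-plugged t u (capp sv (v •))
  °-ssub (letTensor s t) u = °-ssub-plugged s u (clam (t °))
  °-ssub (abort t)       u = °-ssub-plugged t u unitc
  °-ssub (inl t)         u = °-ssub-plugged t u (fstc sv)
  °-ssub (inr t)         u = °-ssub-plugged t u (sndc sv)
  °-ssub (case s t t')   u = °-ssub-plugged s u (pairc (t °) (t' °))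
  °-ssub (lapp s t)      u = °-ssub-plugged t u (lapp (s •) sv)

  •-ssub-applied : (t : Tm Γ (just P) ⌈ Q ⌉) (u : Tm Γ nothing ⌈ P ⌉) (K : Tm (ctx Γ) (just S) ⌈ Q °ᵀ ⌉)
                 → lapp ((ssub t u) •) K ≈ lapp (u •) (ssub (t °) K)
  •-ssub : (t : Tm Γ (just P) ⌈ Q ⌉) (u : Tm Γ nothing ⌈ P ⌉) → (ssub t u) • ≈ llam (lapp (u •) (t °))

  •-ssub-applied t u K = begin
    lapp ((ssub t u) •) K                  ≈⟨ c-lapp (•-ssub t u) ≈-refl ⟩
    lapp (llam (lapp (u •) (t °))) K       ≈⟨ β-⊸ (lapp (u •) (t °)) K ⟩
    lapp (u •) (ssub (t °) K)              ∎

  •-ssub sv              u = ≈-sym (η-⊸ (u •))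
  •-ssub unitc           u = c-llam (≈-sym (comm-abort (lapp (u •) sv) sv))
  •-ssub (pairc t t')    u = c-llam (begin
    case sv (lapp ((ssub t u) •) sv) (lapp ((ssub t' u) •) sv)
      ≈⟨ c-case ≈-refl (unplugged t) (unplugged t') ⟩
    case sv (lapp (u •) (t °)) (lapp (u •) (t' °))
      ≈⟨ comm-case (lapp (u •) sv) sv (t °) (t' °) ⟨
    lapp (u •) (case sv (t °) (t' °))
      ∎)
    where
    unplugged : (r : Tm _ (just _) ⌈ S ⌉) → lapp ((ssub r u) •) sv ≈ lapp (u •) (r °)
    unplugged r = ≈-trans (•-ssub-applied r u sv) (≡⇒≈ (cong (lapp (u •)) (ssub-sv (r °))))
  •-ssub (clam t)        u = c-llam (begin
    letTensor sv (lapp ((ssub t (wk u)) •) sv)   ≈⟨ c-letTensor ≈-refl (•-ssub-applied t (wk u) sv) ⟩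
    letTensor sv (lapp ((wk u) •) (ssub (t °) sv))
      ≡⟨ cong₂ (λ a b → letTensor sv (lapp a b)) (wk• u) (ssub-sv (t °)) ⟩
    letTensor sv (lapp (wk (u •)) (t °))         ≈⟨ comm-letTensor (lapp (u •) sv) sv (t °) ⟨
    lapp (u •) (letTensor sv (t °))              ∎)
  •-ssub (fstc t)        u = c-llam (•-ssub-applied t u (inl sv))
  •-ssub (sndc t)        u = c-llam (•-ssub-applied t u (inr sv))
  •-ssub (capp t v)      u = c-llam (•-ssub-applied t u (tensor (v •) sv))
  •-ssub (letTop t v)    u = c-llam (•-ssub-applied t u (lapp (v •) sv))
  •-ssub (letBang t v)   u = c-llam (•-ssub-applied t u (clam (lapp (v •) sv)))
  •-ssub (tensor v t)    u = c-llam (•-ssub-applied t u (capp sv (v •)))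
  •-ssub (letTensor s t) u = c-llam (•-ssub-applied s u (clam (t °)))
  •-ssub (abort t)       u = c-llam (•-ssub-applied t u unitc)
  •-ssub (inl t)         u = c-llam (•-ssub-applied t u (fstc sv))
  •-ssub (inr t)         u = c-llam (•-ssub-applied t u (sndc sv))
  •-ssub (case s t t')   u = c-llam (•-ssub-applied s u (pairc (t °) (t' °)))
  •-ssub (lapp s t)      u = c-llam (•-ssub-applied t u (lapp (s •) sv))

proposition5p1 : (R : CTy) → let open Trans R in
    (∀ {Γ A B} (t : Tm (Γ ▸ A) nothing B) (u : Tm Γ nothing A)
       → ((t [ u ]₀) •) ≈ ((t •) [ u • ]₀))
    × (∀ {Γ A D Q} (t : Tm (Γ ▸ A) (just D) ⌈ Q ⌉) (u : Tm Γ nothing A)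
       → ((t [ u ]₀) °) ≈ ((t °) [ u • ]₀))
    × (∀ {Γ P Q} (t : Tm Γ (just P) ⌈ Q ⌉) (u : Tm Γ nothing ⌈ P ⌉)
       → ((ssub t u) •) ≈ llam (lapp (u •) (t °)))
    × (∀ {Γ P Q D} (t : Tm Γ (just P) ⌈ Q ⌉) (u : Tm Γ (just D) ⌈ P ⌉)
       → ((ssub t u) °) ≈ ssub (u °) (t °))
proposition5p1 R = inst• , inst° , •-ssub , °-ssub
  where open Translation R
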